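{- Let $\mathcal{A}$ be a preorder-enriched category, and let $(r_X:X\to RX)_{X\in\mathcal{A}}$ be a family of arrows such that for every object $X$, $RX$ is a separated object and there exists an arrow $s_X:RX\to X$ such that $(r_X,s_X)$ is an equivalence. Fix such a choice $s_X$ for each $X$. For a preorder-enriched monad $\hat M=(M,\eta,(-)^*)$ on $\mathcal{A}$ define $\mathsf{T}\hat M=(M',\eta',(-)^{*'})$ by $M'X=R(MX)$, $\eta'_X=r_{MX}\circ\eta_X:X\to M'X$, and for $f:X\to M'Y$, $f^{*'}=r_{MY}\circ(s_{MY}\circ f)^*\circ s_{MX}:M'X\to M'Y$; and define $\mathrm{in}_{\hat M,X}=r_{MX}:MX\to M'X$. Then for every preorder-enriched monad $\hat M$ on $\mathcal{A}$, $\mathsf{T}\hat M$ is a preorder-enriched monad on $\mathcal{A}$ and $\mathrm{in}_{\hat M}=(\mathrm{in}_{\hat M,X})_X$ is a monad map from $\hat M$ to $\mathsf{T}\hat M$ (so $(\mathsf{T},\mathrm{in})$ is a basic monad transformer). Moreover, $\mathsf{T}\hat M$ does not depend on the choice of the arrows $s_X$.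
   Context: A preorder-enriched category is a category whose hom-sets $\mathcal{A}(X,Y)$ are preorders and whose composition is monotone in both arguments. Two parallel arrows $f,g$ are equivalent ($f\sim g$) if $f\leq g$ and $g\leq f$. An object $Y$ is separated if $\mathcal{A}(X,Y)$ is a partial order for every object $X$. A pair of arrows $f:X\to Y$, $g:Y\to X$ is an equivalence if $\mathrm{id}_Y\leq f\circ g\leq\mathrm{id}_Y$ and $\mathrm{id}_X\leq g\circ f\leq\mathrm{id}_X$. A preorder-enriched monad on $\mathcal{A}$ is a triple $\hat M=(M,\eta,(-)^*)$ where $M$ maps objects to objects, $\eta_X:X\to MX$ are arrows, and $(-)^*$ is a family of monotone maps $\mathcal{A}(X,MY)\to\mathcal{A}(MX,MY)$, satisfying $\eta_X^*=\mathrm{id}_{MX}$, $f^*\circ\eta_X=f$, and $g^*\circ f^*=(g^*\circ f)^*$. A monad map $\theta$ from $\hat M$ to $\hat M'=(M',\eta',(-)^{*'})$ is a family of arrows $\theta_X:MX\to M'X$ such that $\theta_X\circ\eta_X=\eta'_X$ and $\theta_Y\circ f^*=(\theta_Y\circ f)^{*'}\circ\theta_X$ for every $f:X\to MY$. A basic monad transformer is a pair $(\mathsf{T},\mathrm{in})$ where $\mathsf{T}$ maps preorder-enriched monads to preorder-enriched monads and $\mathrm{in}_{\hat M}$ is a monad map from $\hat M$ to $\mathsf{T}\hat M$. -}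

module Defs where

open import Level using (Level; _⊔_; suc)
open import Relation.Binary.PropositionalEquality using (_≡_)
open import Data.Product using (_×_)

record PreorderEnrichedCategory (o h ℓ : Level) : Set (suc (o ⊔ h ⊔ ℓ)) where
  infixr 9 _∘_
  infix 4 _≤_
  field
    Obj   : Set o
    Hom   : Obj → Obj → Set h
    _≤_   : ∀ {X Y} → Hom X Y → Hom X Y → Set ℓ
    ≤-refl  : ∀ {X Y} {f : Hom X Y} → f ≤ f
    ≤-trans : ∀ {X Y} {f g k : Hom X Y} → f ≤ g → g ≤ k → f ≤ k
    id    : ∀ {X} → Hom X X
    _∘_   : ∀ {X Y Z} → Hom Y Z → Hom X Y → Hom X Z
    identityˡ : ∀ {X Y} {f : Hom X Y} → id ∘ f ≡ f
    identityʳ : ∀ {X Y} {f : Hom X Y} → f ∘ id ≡ f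
    assoc : ∀ {W X Y Z} {f : Hom W X} {g : Hom X Y} {k : Hom Y Z} →
            (k ∘ g) ∘ f ≡ k ∘ (g ∘ f)
    ∘-mono : ∀ {X Y Z} {g g' : Hom Y Z} {f f' : Hom X Y} →
             g ≤ g' → f ≤ f' → g ∘ f ≤ g' ∘ f'

module _ {o h ℓ} (𝒜 : PreorderEnrichedCategory o h ℓ) where
  open PreorderEnrichedCategory 𝒜

  _∼_ : ∀ {X Y} → Hom X Y → Hom X Y → Set ℓ
  f ∼ g = (f ≤ g) × (g ≤ f)

  Separated : Obj → Set (o ⊔ h ⊔ ℓ)
  Separated Y = ∀ {X} (f g : Hom X Y) → f ≤ g → g ≤ f → f ≡ g

  IsEquivalencePair : ∀ {X Y} → Hom X Y → Hom Y X → Set ℓ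
  IsEquivalencePair {X} {Y} f g =
    (id ≤ f ∘ g) × (f ∘ g ≤ id) × (id ≤ g ∘ f) × (g ∘ f ≤ id)

  record MonadData : Set (o ⊔ h) where
    field
      M   : Obj → Obj
      η   : ∀ X → Hom X (M X)
      ext : ∀ {X Y} → Hom X (M Y) → Hom (M X) (M Y)

  record IsPreorderEnrichedMonad (T : MonadData) : Set (o ⊔ h ⊔ ℓ) where
    open MonadData T
    field
      ext-mono : ∀ {X Y} {f g : Hom X (M Y)} → f ≤ g → ext f ≤ ext g
      ext-η    : ∀ {X} → ext (η X) ≡ id
      ext-unit : ∀ {X Y} (f : Hom X (M Y)) → ext f ∘ η X ≡ f
      ext-comp : ∀ {X Y Z} (f : Hom X (M Y)) (g : Hom Y (M Z)) →
                 ext g ∘ ext f ≡ ext (ext g ∘ f)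

  record IsMonadMap (T T' : MonadData)
         (θ : ∀ X → Hom (MonadData.M T X) (MonadData.M T' X)) : Set (o ⊔ h) where
    private
      module T  = MonadData T
      module T' = MonadData T'
    field
      unit : ∀ X → θ X ∘ T.η X ≡ T'.η X
      bind : ∀ {X Y} (f : Hom X (T.M Y)) →
             θ Y ∘ T.ext f ≡ T'.ext (θ Y ∘ f) ∘ θ X

  𝖳 : (R : Obj → Obj) (r : ∀ X → Hom X (R X)) (s : ∀ X → Hom (R X) X) →
      MonadData → MonadData
  𝖳 R r s T = record
    { M   = λ X → R (M X)
    ; η   = λ X → r (M X) ∘ η X
    ; ext = λ {X} {Y} f → r (M Y) ∘ ext (s (M Y) ∘ f) ∘ s (M X)
    }
    where open MonadData T

-- Since R X is separated and (r X , s X) is an equivalence, r X ∘ s X ≡ id,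
-- while s X ∘ r X ∼ id. The monad laws of 𝖳 M̂ and the monad-map laws of r
-- therefore hold up to ∼ after cancelling each inner s ∘ r, and every arrow
-- involved lands in some R (M Y), so ∼ upgrades to ≡. Independence of s holds
-- because two quasi-inverses of r are equivalent.
module Submission where

open import Defs
open import Data.Product using (_×_; _,_; proj₁; proj₂; swap)
open import Relation.Binary.Bundles using (Setoid)
open import Relation.Binary.PropositionalEquality using (_≡_; refl; cong; module ≡-Reasoning)
import Relation.Binary.Reasoning.Setoid as SetoidReasoning

module _ {o h ℓ} (𝒜 : PreorderEnrichedCategory o h ℓ) where
  open PreorderEnrichedCategory 𝒜

  infix 4 _≈_
  _≈_ : ∀ {X Y} → Hom X Y → Hom X Y → Set ℓ
  _≈_ = _∼_ 𝒜

  ∼-setoid : Obj → Obj → Setoid h ℓ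
  ∼-setoid X Y = record
    { Carrier       = Hom X Y
    ; _≈_           = _≈_
    ; isEquivalence = record
      { refl  = ≤-refl , ≤-refl
      ; sym   = swap
      ; trans = λ (f≤g , g≤f) (g≤k , k≤g) → ≤-trans f≤g g≤k , ≤-trans k≤g g≤f
      }
    }

  module ∼ {X Y : Obj} = Setoid (∼-setoid X Y)

  ∘-resp-∼ : ∀ {X Y Z} {g g' : Hom Y Z} {f f' : Hom X Y} →
             g ≈ g' → f ≈ f' → g ∘ f ≈ g' ∘ f'
  ∘-resp-∼ (g≤g' , g'≤g) (f≤f' , f'≤f) = ∘-mono g≤g' f≤f' , ∘-mono g'≤g f'≤f

  ∘-respˡ-∼ : ∀ {X Y Z} {g g' : Hom Y Z} (f : Hom X Y) → g ≈ g' → g ∘ f ≈ g' ∘ f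
  ∘-respˡ-∼ f g≈g' = ∘-resp-∼ g≈g' ∼.refl

  ∘-respʳ-∼ : ∀ {X Y Z} (g : Hom Y Z) {f f' : Hom X Y} → f ≈ f' → g ∘ f ≈ g ∘ f'
  ∘-respʳ-∼ g f≈f' = ∘-resp-∼ ∼.refl f≈f'

  separated-∼⇒≡ : ∀ {X Y} → Separated 𝒜 Y → {f g : Hom X Y} → f ≈ g → f ≡ g
  separated-∼⇒≡ sep {f} {g} (f≤g , g≤f) = sep f g f≤g g≤f

  module EquivalencePair {X Y} {r : Hom X Y} {s : Hom Y X}
                         (eqv : IsEquivalencePair 𝒜 r s) where

    r∘s∼id : r ∘ s ≈ id
    r∘s∼id = proj₁ (proj₂ eqv) , proj₁ eqv

    s∘r∼id : s ∘ r ≈ id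
    s∘r∼id = proj₂ (proj₂ (proj₂ eqv)) , proj₁ (proj₂ (proj₂ eqv))

    r∘s≡id : Separated 𝒜 Y → r ∘ s ≡ id
    r∘s≡id sep = separated-∼⇒≡ sep r∘s∼id

    cancelˡ : ∀ {W} (f : Hom W X) → s ∘ (r ∘ f) ≈ f
    cancelˡ f = begin
      s ∘ (r ∘ f) ≡⟨ assoc ⟨
      (s ∘ r) ∘ f ≈⟨ ∘-respˡ-∼ f s∘r∼id ⟩
      id ∘ f      ≡⟨ identityˡ ⟩
      f           ∎
      where open SetoidReasoning (∼-setoid _ _)

    cancelInner : ∀ {V W} (g : Hom X W) (f : Hom V X) → (g ∘ s) ∘ (r ∘ f) ≈ g ∘ f
    cancelInner g f = begin
      (g ∘ s) ∘ (r ∘ f) ≡⟨ assoc ⟩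
      g ∘ (s ∘ (r ∘ f)) ≈⟨ ∘-respʳ-∼ g (cancelˡ f) ⟩
      g ∘ f             ∎
      where open SetoidReasoning (∼-setoid _ _)

  quasi-inverse-unique : ∀ {X Y} {r : Hom X Y} {s s' : Hom Y X} →
                         IsEquivalencePair 𝒜 r s → IsEquivalencePair 𝒜 r s' → s ≈ s'
  quasi-inverse-unique {r = r} {s} {s'} eqv eqv' = begin
    s            ≡⟨ identityʳ ⟨
    s ∘ id       ≈⟨ ∘-respʳ-∼ s (EquivalencePair.r∘s∼id eqv') ⟨
    s ∘ (r ∘ s') ≈⟨ EquivalencePair.cancelˡ eqv s' ⟩
    s'           ∎
    where open SetoidReasoning (∼-setoid _ _)

  module Transport
    (R : Obj → Obj) (r : ∀ X → Hom X (R X)) (sep : ∀ X → Separated 𝒜 (R X))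
    (s : ∀ X → Hom (R X) X) (eqv : ∀ X → IsEquivalencePair 𝒜 (r X) (s X))
    (T : MonadData 𝒜) (isMonad : IsPreorderEnrichedMonad 𝒜 T) where

    open MonadData T
    open IsPreorderEnrichedMonad isMonad
    module E X = EquivalencePair (eqv X)
    module T′ = MonadData (𝖳 𝒜 R r s T)

    ext-resp-∼ : ∀ {X Y} {f g : Hom X (M Y)} → f ≈ g → ext f ≈ ext g
    ext-resp-∼ (f≤g , g≤f) = ext-mono f≤g , ext-mono g≤f

    ∼⇒≡ : ∀ {X Y} {f g : Hom X (R Y)} → f ≈ g → f ≡ g
    ∼⇒≡ = separated-∼⇒≡ (sep _)

    r∘s-cancelˡ : ∀ {X Y} (f : Hom X (R Y)) → r Y ∘ (s Y ∘ f) ≡ f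
    r∘s-cancelˡ {Y = Y} f = begin
      r Y ∘ (s Y ∘ f) ≡⟨ assoc ⟨
      (r Y ∘ s Y) ∘ f ≡⟨ cong (_∘ f) (E.r∘s≡id Y (sep Y)) ⟩
      id ∘ f          ≡⟨ identityˡ ⟩
      f               ∎
      where open ≡-Reasoning

    ext′-mono : ∀ {X Y} {f g : Hom X (R (M Y))} → f ≤ g → T′.ext f ≤ T′.ext g
    ext′-mono f≤g = ∘-mono ≤-refl (∘-mono (ext-mono (∘-mono ≤-refl f≤g)) ≤-refl)

    ext′-η : ∀ {X} → T′.ext (T′.η X) ≡ id
    ext′-η {X} = ∼⇒≡ (begin
      r (M X) ∘ ext (s (M X) ∘ (r (M X) ∘ η X)) ∘ s (M X)
        ≈⟨ ∘-respʳ-∼ (r (M X)) (∘-respˡ-∼ (s (M X)) (ext-resp-∼ (E.cancelˡ (M X) (η X)))) ⟩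
      r (M X) ∘ ext (η X) ∘ s (M X) ≡⟨ cong (λ e → r (M X) ∘ e ∘ s (M X)) ext-η ⟩
      r (M X) ∘ id ∘ s (M X)        ≡⟨ cong (r (M X) ∘_) identityˡ ⟩
      r (M X) ∘ s (M X)             ≡⟨ E.r∘s≡id (M X) (sep (M X)) ⟩
      id                            ∎)
      where open SetoidReasoning (∼-setoid _ _)

    ext′-unit : ∀ {X Y} (f : Hom X (R (M Y))) → T′.ext f ∘ T′.η X ≡ f
    ext′-unit {X} {Y} f = ∼⇒≡ (begin
      (r (M Y) ∘ ext (s (M Y) ∘ f) ∘ s (M X)) ∘ (r (M X) ∘ η X) ≡⟨ assoc ⟩
      r (M Y) ∘ (ext (s (M Y) ∘ f) ∘ s (M X)) ∘ (r (M X) ∘ η X)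
        ≈⟨ ∘-respʳ-∼ (r (M Y)) (E.cancelInner (M X) (ext (s (M Y) ∘ f)) (η X)) ⟩
      r (M Y) ∘ ext (s (M Y) ∘ f) ∘ η X ≡⟨ cong (r (M Y) ∘_) (ext-unit _) ⟩
      r (M Y) ∘ s (M Y) ∘ f             ≡⟨ r∘s-cancelˡ f ⟩
      f                                 ∎)
      where open SetoidReasoning (∼-setoid _ _)

    s∘ext′ : ∀ {W X Y} (g : Hom X (R (M Y))) (f : Hom W (R (M X))) →
             s (M Y) ∘ (T′.ext g ∘ f) ≈ ext (s (M Y) ∘ g) ∘ (s (M X) ∘ f)
    s∘ext′ {X = X} {Y} g f = begin
      s (M Y) ∘ ((r (M Y) ∘ ext (s (M Y) ∘ g) ∘ s (M X)) ∘ f) ≡⟨ cong (s (M Y) ∘_) assoc ⟩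
      s (M Y) ∘ r (M Y) ∘ ((ext (s (M Y) ∘ g) ∘ s (M X)) ∘ f) ≈⟨ E.cancelˡ (M Y) _ ⟩
      (ext (s (M Y) ∘ g) ∘ s (M X)) ∘ f                         ≡⟨ assoc ⟩
      ext (s (M Y) ∘ g) ∘ s (M X) ∘ f                           ∎
      where open SetoidReasoning (∼-setoid _ _)

    ext′-comp : ∀ {X Y Z} (f : Hom X (R (M Y))) (g : Hom Y (R (M Z))) →
                T′.ext g ∘ T′.ext f ≡ T′.ext (T′.ext g ∘ f)
    ext′-comp {X} {Y} {Z} f g = ∼⇒≡ (begin
      (r (M Z) ∘ G ∘ s (M Y)) ∘ (r (M Y) ∘ F ∘ s (M X)) ≡⟨ assoc ⟩
      r (M Z) ∘ (G ∘ s (M Y)) ∘ (r (M Y) ∘ F ∘ s (M X))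
        ≈⟨ ∘-respʳ-∼ (r (M Z)) (E.cancelInner (M Y) G (F ∘ s (M X))) ⟩
      r (M Z) ∘ G ∘ F ∘ s (M X)   ≡⟨ cong (r (M Z) ∘_) assoc ⟨
      r (M Z) ∘ (G ∘ F) ∘ s (M X) ≡⟨ cong (λ e → r (M Z) ∘ e ∘ s (M X)) (ext-comp _ _) ⟩
      r (M Z) ∘ ext (G ∘ s (M Y) ∘ f) ∘ s (M X)
        ≈⟨ ∘-respʳ-∼ (r (M Z)) (∘-respˡ-∼ (s (M X)) (ext-resp-∼ (s∘ext′ g f))) ⟨
      r (M Z) ∘ ext (s (M Z) ∘ T′.ext g ∘ f) ∘ s (M X) ∎)
      where
      open SetoidReasoning (∼-setoid _ _)
      G = ext (s (M Z) ∘ g)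
      F = ext (s (M Y) ∘ f)

    isPreorderEnrichedMonad : IsPreorderEnrichedMonad 𝒜 (𝖳 𝒜 R r s T)
    isPreorderEnrichedMonad = record
      { ext-mono = ext′-mono
      ; ext-η    = ext′-η
      ; ext-unit = ext′-unit
      ; ext-comp = ext′-comp
      }

    in-bind : ∀ {X Y} (f : Hom X (M Y)) →
              r (M Y) ∘ ext f ≡ T′.ext (r (M Y) ∘ f) ∘ r (M X)
    in-bind {X} {Y} f = ∼⇒≡ (∼.sym (begin
      (r (M Y) ∘ ext (s (M Y) ∘ r (M Y) ∘ f) ∘ s (M X)) ∘ r (M X) ≡⟨ assoc ⟩
      r (M Y) ∘ (ext (s (M Y) ∘ r (M Y) ∘ f) ∘ s (M X)) ∘ r (M X) ≡⟨ cong (r (M Y) ∘_) assoc ⟩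
      r (M Y) ∘ ext (s (M Y) ∘ r (M Y) ∘ f) ∘ s (M X) ∘ r (M X)
        ≈⟨ ∘-respʳ-∼ (r (M Y)) (∘-resp-∼ (ext-resp-∼ (E.cancelˡ (M Y) f)) (E.s∘r∼id (M X))) ⟩
      r (M Y) ∘ ext f ∘ id ≡⟨ cong (r (M Y) ∘_) identityʳ ⟩
      r (M Y) ∘ ext f      ∎))
      where open SetoidReasoning (∼-setoid _ _)

    in-isMonadMap : IsMonadMap 𝒜 T (𝖳 𝒜 R r s T) (λ X → r (M X))
    in-isMonadMap = record { unit = λ _ → refl ; bind = in-bind }

    ext′-independent-of-s :
      (s' : ∀ X → Hom (R X) X) → (∀ X → IsEquivalencePair 𝒜 (r X) (s' X)) →
      ∀ {X Y} (f : Hom X (R (M Y))) → T′.ext f ≡ MonadData.ext (𝖳 𝒜 R r s' T) f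
    ext′-independent-of-s s' eqv' {X} {Y} f = ∼⇒≡
      (∘-respʳ-∼ (r (M Y)) (∘-resp-∼ (ext-resp-∼ (∘-respˡ-∼ f (s∼s' (M Y)))) (s∼s' (M X))))
      where
      s∼s' : ∀ Z → s Z ≈ s' Z
      s∼s' Z = quasi-inverse-unique (eqv Z) (eqv' Z)

theorem2 : ∀ {o h ℓ} (𝒜 : PreorderEnrichedCategory o h ℓ) →
  let open PreorderEnrichedCategory 𝒜 in
  (R : Obj → Obj) (r : ∀ X → Hom X (R X)) →
  (sep : ∀ X → Separated 𝒜 (R X)) →
  (s : ∀ X → Hom (R X) X) → (eqv : ∀ X → IsEquivalencePair 𝒜 (r X) (s X)) →
  (T : MonadData 𝒜) → IsPreorderEnrichedMonad 𝒜 T →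
  IsPreorderEnrichedMonad 𝒜 (𝖳 𝒜 R r s T)
  × IsMonadMap 𝒜 T (𝖳 𝒜 R r s T) (λ X → r (MonadData.M T X))
  × ((s' : ∀ X → Hom (R X) X) → (∀ X → IsEquivalencePair 𝒜 (r X) (s' X)) →
     ∀ {X Y} (f : Hom X (R (MonadData.M T Y))) →
     MonadData.ext (𝖳 𝒜 R r s T) f ≡ MonadData.ext (𝖳 𝒜 R r s' T) f)
theorem2 𝒜 R r sep s eqv T isMonad =
  isPreorderEnrichedMonad , in-isMonadMap , ext′-independent-of-s
  where open Transport 𝒜 R r sep s eqv T isMonad
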